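{- For every $\epsilon>0$ there exists $\delta>0$ such that for every colored graph $G=(V,c)$ and any two partitions $P,Q$ of $V$ that are $\delta$-close, $|\mathrm{ind}(P)-\mathrm{ind}(Q)|\leq\epsilon$.
   Context: $G=(V,c)$ is a $\Sigma$-colored graph: $V$ a finite set of size $n$, $c:\binom{V}{2}\to\Sigma$, $\Sigma$ finite. For disjoint $U,W\subseteq V$ and $\sigma\in\Sigma$, $d_\sigma(U,W)=|\{\{u,w\}:u\in U,w\in W,c(uw)=\sigma\}|/(|U||W|)$ and $\mathrm{ind}(U,W)=\sum_{\sigma\in\Sigma}d_\sigma(U,W)^2$. For a partition $P=(V_1,\dots,V_k)$ of $V$ (a sequence of disjoint sets with union $V$), $\mathrm{ind}(P)=\sum_{1\le i<i'\le k}\frac{|V_i||V_{i'}|}{\binom{|V|}{2}}\mathrm{ind}(V_i,V_{i'})$. Partitions $P=(V_1,\dots,V_k)$ and $Q=(U_1,\dots,U_l)$ of $V$ are $\delta$-close if there is $T\subseteq V$ with $|T|\le\delta n$ such that $V_i\setminus T=U_i\setminus T$ for every $1\le i\le\max\{k,l\}$, where $V_i=\emptyset$ for $i>k$ and $U_i=\emptyset$ for $i>l$.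
   Formalization: The parameter $\epsilon$ ranges over the positive rationals, and $\delta$ is taken in the rationals. -}

module Defs where

open import Data.Nat as ℕ using (ℕ; zero; suc)
open import Data.Nat.Combinatorics using (_C_)
open import Data.Integer using (+_)
open import Data.Rational using (ℚ; 0ℚ; _/_; _+_; _*_; _≤_; _<_)
open import Data.Fin using (Fin; toℕ) renaming (zero to Fz; suc to Fs)
open import Data.Fin.Subset using (Subset; _∉_; ∣_∣)
open import Relation.Binary.PropositionalEquality using (_≡_)
open import Relation.Nullary using (Dec; yes; no)
open import Relation.Nullary.Decidable using (⌊_⌋)
open import Data.Fin using (_≟_)
open import Data.Nat using (_<?_)
open import Data.Product using (Σ; _×_)
open import Function.Bundles using (_⇔_)

ℕ→ℚ : ℕ → ℚ
ℕ→ℚ a = + a / 1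

-- a / b as a rational, with the convention a / 0 = 0
-- (only ever used where the quantity is multiplied by 0 anyway, or for n ≤ 1).
_÷ℕ_ : ℕ → ℕ → ℚ
a ÷ℕ zero  = 0ℚ
a ÷ℕ suc b = + a / suc b

sumℚ : (m : ℕ) → (Fin m → ℚ) → ℚ
sumℚ zero    f = 0ℚ
sumℚ (suc m) f = f Fz + sumℚ m (λ i → f (Fs i))

sumℕ : (m : ℕ) → (Fin m → ℕ) → ℕ
sumℕ zero    f = 0
sumℕ (suc m) f = f Fz ℕ.+ sumℕ m (λ i → f (Fs i))

𝟙 : {P : Set} → Dec P → ℕ
𝟙 (yes _) = 1
𝟙 (no  _) = 0

-- A Σ-colored graph on V = Fin n with Σ = Fin s: a colouring of unordered
-- pairs, represented by a symmetric function on ordered pairs (the diagonal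
-- is irrelevant).
record ColoredGraph (n s : ℕ) : Set where
  field
    col : Fin n → Fin n → Fin s
    sym : ∀ u w → col u w ≡ col w u

-- A partition (V_1,…,V_k) of V = Fin n (a sequence of k disjoint, possibly
-- empty, sets covering V), represented by the block-assignment map:
-- V_i = { v | blk v = i }.
Partition : ℕ → ℕ → Set
Partition n k = Fin n → Fin k

module _ {n s k : ℕ} (G : ColoredGraph n s) (P : Partition n k) where
  open ColoredGraph G

  size : Fin k → ℕ
  size i = sumℕ n (λ v → 𝟙 (P v ≟ i))

  count : Fin s → Fin k → Fin k → ℕ
  count σ i i' = sumℕ n (λ u → sumℕ n (λ w →
                   𝟙 (P u ≟ i) ℕ.* 𝟙 (P w ≟ i') ℕ.* 𝟙 (col u w ≟ σ)))

  dens : Fin s → Fin k → Fin k → ℚ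
  dens σ i i' = count σ i i' ÷ℕ (size i ℕ.* size i')

  indPair : Fin k → Fin k → ℚ
  indPair i i' = sumℚ s (λ σ → dens σ i i' * dens σ i i')

  ind : ℚ
  ind = sumℚ k (λ i → sumℚ k (λ i' →
          ℕ→ℚ (𝟙 (toℕ i <? toℕ i'))
          * ((size i ℕ.* size i') ÷ℕ (n C 2))
          * indPair i i'))

-- P = (V_1..V_k) and Q = (U_1..U_l) are δ-close: there is T ⊆ V with
-- |T| ≤ δ n such that V_i \ T = U_i \ T for every index i
-- (blocks with index beyond k resp. l are empty).
Close : {n k l : ℕ} → ℚ → Partition n k → Partition n l → Set
Close {n} δ P Q = Σ (Subset n) λ T →
    (ℕ→ℚ ∣ T ∣ ≤ δ * ℕ→ℚ n)
  × (∀ (i : ℕ) (v : Fin n) → v ∉ T → (toℕ (P v) ≡ i ⇔ toℕ (Q v) ≡ i))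

module Submission where

-- C(n,2)·ind(P) is a sum over pairs of blocks i < j of Σ_σ e_σ² / Σ_σ e_σ, where e_σ counts
-- the σ-coloured pairs between the two blocks, so that Σ_σ e_σ = |V_i||V_j|.  Lowering the
-- counts from e to e′ ≤ e moves Σe²/Σe by at most 2(Σe − Σe′).  If P and Q agree outside T,
-- deleting T from their blocks gives the same family, and the deletion lowers
-- Σ_{i,j} |V_i||V_j| by at most 2|T|n.  Hence C(n,2)·|ind(P) − ind(Q)| ≤ 8|T|n ≤ 8δn², and
-- as n² ≤ 4·C(n,2), δ = ε/32 suffices.

open import Defs
open import Data.Bool.Base using (true; false; if_then_else_)
open import Data.Empty using (⊥-elim)
open import Data.Fin.Base using (Fin; toℕ) renaming (zero to Fz; suc to Fs)
import Data.Fin.Properties as Finₚ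
open import Data.Fin.Subset as Subset using (Subset; _∉_)
open import Data.Nat.Base as ℕ using (ℕ; zero; suc)
import Data.Nat.Properties as ℕₚ
open import Data.Nat.Combinatorics using (_C_)
open import Data.Product using (Σ; _×_; _,_)
open import Data.Sum using (inj₁; inj₂)
open import Data.Vec.Base using ([]; _∷_; lookup)
open import Function.Base using (_∘_)
open import Function.Bundles using (_⇔_; Equivalence)
import Function.Properties.Equivalence as ⇔
open import Relation.Binary.PropositionalEquality
open import Relation.Nullary using (Dec; yes; no; ¬_)

𝟙-cong : ∀ {A B : Set} (a? : Dec A) (b? : Dec B) → (A → B) → (B → A) → 𝟙 a? ≡ 𝟙 b?
𝟙-cong (yes _) (yes _) _   _   = refl
𝟙-cong (yes a) (no ¬b) a→b _   = ⊥-elim (¬b (a→b a))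
𝟙-cong (no ¬a) (yes b) _   b→a = ⊥-elim (¬a (b→a b))
𝟙-cong (no _)  (no _)  _   _   = refl

𝟙-no : ∀ {A : Set} (a? : Dec A) → ¬ A → 𝟙 a? ≡ 0
𝟙-no (yes a) ¬a = ⊥-elim (¬a a)
𝟙-no (no _)  _  = refl

module NatSums where
  open import Data.Nat.Base
  open import Data.Nat.Properties
  import Algebra.Properties.Semiring.Sum +-*-semiring as ∑

  sumℕ< : ℕ → (ℕ → ℕ) → ℕ
  sumℕ< K f = sumℕ K (f ∘ toℕ)

  sumℕ≡sum : ∀ m (f : Fin m → ℕ) → sumℕ m f ≡ ∑.sum f
  sumℕ≡sum zero    f = refl
  sumℕ≡sum (suc m) f = cong (f Fz +_) (sumℕ≡sum m (f ∘ Fs))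

  sumℕ-cong : ∀ m {f g : Fin m → ℕ} → (∀ i → f i ≡ g i) → sumℕ m f ≡ sumℕ m g
  sumℕ-cong zero    f≡g = refl
  sumℕ-cong (suc m) f≡g = cong₂ _+_ (f≡g Fz) (sumℕ-cong m (f≡g ∘ Fs))

  sumℕ-mono-≤ : ∀ m {f g : Fin m → ℕ} → (∀ i → f i ≤ g i) → sumℕ m f ≤ sumℕ m g
  sumℕ-mono-≤ zero    f≤g = z≤n
  sumℕ-mono-≤ (suc m) f≤g = +-mono-≤ (f≤g Fz) (sumℕ-mono-≤ m (f≤g ∘ Fs))

  sumℕ-+ : ∀ m (f g : Fin m → ℕ) → sumℕ m (λ i → f i + g i) ≡ sumℕ m f + sumℕ m g
  sumℕ-+ m f g = begin
    sumℕ m (λ i → f i + g i)  ≡⟨ sumℕ≡sum m _ ⟩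
    ∑.sum (λ i → f i + g i)   ≡⟨ ∑.∑-distrib-+ f g ⟩
    ∑.sum f + ∑.sum g         ≡⟨ cong₂ _+_ (sumℕ≡sum m f) (sumℕ≡sum m g) ⟨
    sumℕ m f + sumℕ m g       ∎
    where open ≡-Reasoning

  sumℕ-*ˡ : ∀ m c (f : Fin m → ℕ) → sumℕ m (λ i → c * f i) ≡ c * sumℕ m f
  sumℕ-*ˡ m c f = begin
    sumℕ m (λ i → c * f i)  ≡⟨ sumℕ≡sum m _ ⟩
    ∑.sum (λ i → c * f i)   ≡⟨ ∑.*-distribˡ-sum c f ⟨
    c * ∑.sum f             ≡⟨ cong (c *_) (sumℕ≡sum m f) ⟨
    c * sumℕ m f            ∎
    where open ≡-Reasoning

  sumℕ-*ʳ : ∀ m c (f : Fin m → ℕ) → sumℕ m (λ i → f i * c) ≡ sumℕ m f * c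
  sumℕ-*ʳ m c f = begin
    sumℕ m (λ i → f i * c)  ≡⟨ sumℕ-cong m (λ i → *-comm (f i) c) ⟩
    sumℕ m (λ i → c * f i)  ≡⟨ sumℕ-*ˡ m c f ⟩
    c * sumℕ m f            ≡⟨ *-comm c _ ⟩
    sumℕ m f * c            ∎
    where open ≡-Reasoning

  sumℕ-comm : ∀ m k (f : Fin m → Fin k → ℕ) →
              sumℕ m (λ i → sumℕ k (f i)) ≡ sumℕ k (λ j → sumℕ m (λ i → f i j))
  sumℕ-comm m k f = begin
    sumℕ m (λ i → sumℕ k (f i))              ≡⟨ sumℕ-cong m (λ i → sumℕ≡sum k (f i)) ⟩
    sumℕ m (λ i → ∑.sum (f i))               ≡⟨ sumℕ≡sum m _ ⟩
    ∑.sum (λ i → ∑.sum (f i))                ≡⟨ ∑.∑-comm f ⟩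
    ∑.sum (λ j → ∑.sum (λ i → f i j))        ≡⟨ sumℕ≡sum k _ ⟨
    sumℕ k (λ j → ∑.sum (λ i → f i j))       ≡⟨ sumℕ-cong k (λ j → sumℕ≡sum m (λ i → f i j)) ⟨
    sumℕ k (λ j → sumℕ m (λ i → f i j))      ∎
    where open ≡-Reasoning

  sumℕ-∸ : ∀ m {f g : Fin m → ℕ} → (∀ i → g i ≤ f i) →
           sumℕ m (λ i → f i ∸ g i) ≡ sumℕ m f ∸ sumℕ m g
  sumℕ-∸ m {f} {g} g≤f = begin
    sumℕ m (λ i → f i ∸ g i)                              ≡⟨ m+n∸n≡m _ (sumℕ m g) ⟨
    sumℕ m (λ i → f i ∸ g i) + sumℕ m g ∸ sumℕ m g        ≡⟨ cong (_∸ sumℕ m g) (sumℕ-+ m _ g) ⟨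
    sumℕ m (λ i → f i ∸ g i + g i) ∸ sumℕ m g             ≡⟨ cong (_∸ sumℕ m g) (sumℕ-cong m (λ i → m∸n+n≡m (g≤f i))) ⟩
    sumℕ m f ∸ sumℕ m g                                   ∎
    where open ≡-Reasoning

  term≤sumℕ : ∀ m (f : Fin m → ℕ) i → f i ≤ sumℕ m f
  term≤sumℕ (suc m) f Fz     = m≤m+n (f Fz) _
  term≤sumℕ (suc m) f (Fs i) = ≤-trans (term≤sumℕ m (f ∘ Fs) i) (m≤n+m _ (f Fz))

  sumℕ-const-1 : ∀ m → sumℕ m (λ _ → 1) ≡ m
  sumℕ-const-1 zero    = refl
  sumℕ-const-1 (suc m) = cong suc (sumℕ-const-1 m)

  sumℕ-const-0 : ∀ m → sumℕ m (λ _ → 0) ≡ 0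
  sumℕ-const-0 zero    = refl
  sumℕ-const-0 (suc m) = sumℕ-const-0 m

  sumℕ-*-sumℕ : ∀ m k (f : Fin m → ℕ) (g : Fin k → ℕ) →
                sumℕ m (λ i → sumℕ k (λ j → f i * g j)) ≡ sumℕ m f * sumℕ k g
  sumℕ-*-sumℕ m k f g = trans (sumℕ-cong m (λ i → sumℕ-*ˡ k (f i) g)) (sumℕ-*ʳ m (sumℕ k g) f)

  sumℕ<-𝟙-≡ : ∀ K x → x < K → sumℕ< K (λ i → 𝟙 (x ≟ i)) ≡ 1
  sumℕ<-𝟙-≡ (suc K) zero    _         = cong suc (sumℕ-const-0 K)
  sumℕ<-𝟙-≡ (suc K) (suc x) (s≤s x<K) = begin
    sumℕ< K (λ i → 𝟙 (suc x ≟ suc i))  ≡⟨ sumℕ-cong K (λ i → 𝟙-cong (suc x ≟ suc (toℕ i)) (x ≟ toℕ i) suc-injective (cong suc)) ⟩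
    sumℕ< K (λ i → 𝟙 (x ≟ i))          ≡⟨ sumℕ<-𝟙-≡ K x x<K ⟩
    1                                  ∎
    where open ≡-Reasoning

  sumℕ-𝟙-≡ : ∀ s (x : Fin s) → sumℕ s (λ σ → 𝟙 (x Finₚ.≟ σ)) ≡ 1
  sumℕ-𝟙-≡ s x = begin
    sumℕ s (λ σ → 𝟙 (x Finₚ.≟ σ))         ≡⟨ sumℕ-cong s (λ σ → 𝟙-cong (x Finₚ.≟ σ) (toℕ x ≟ toℕ σ) (cong toℕ) Finₚ.toℕ-injective) ⟩
    sumℕ< s (λ i → 𝟙 (toℕ x ≟ i))        ≡⟨ sumℕ<-𝟙-≡ s (toℕ x) (Finₚ.toℕ<n x) ⟩
    1                                    ∎
    where open ≡-Reasoning

open NatSums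

module SumsOfSquares where
  open import Data.Nat.Base
  open import Data.Nat.Properties
  open import Data.Nat.Solver using (module +-*-Solver)
  open +-*-Solver

  m*m≤n*n+2*[m∸n]*o : ∀ {m n o} → n ≤ m → m ≤ o → m * m ≤ n * n + 2 * (m ∸ n) * o
  m*m≤n*n+2*[m∸n]*o {m} {n} {o} n≤m m≤o = begin
    m * m                          ≡⟨ cong (λ x → x * x) (m+[n∸m]≡n n≤m) ⟨
    (n + d) * (n + d)              ≡⟨ solve 2 (λ n d → (n :+ d) :* (n :+ d) := n :* n :+ d :* (n :+ (n :+ d))) refl n d ⟩
    n * n + d * (n + (n + d))      ≤⟨ +-monoʳ-≤ (n * n) (*-monoʳ-≤ d (+-mono-≤ (≤-trans n≤m m≤o) (≤-trans (≤-reflexive (m+[n∸m]≡n n≤m)) m≤o))) ⟩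
    n * n + d * (o + o)            ≡⟨ cong (n * n +_) (solve 2 (λ d o → d :* (o :+ o) := con 2 :* d :* o) refl d o) ⟩
    n * n + 2 * d * o              ∎
    where
    open ≤-Reasoning
    d = m ∸ n

  sumSq : (s : ℕ) → (Fin s → ℕ) → ℕ
  sumSq s c = sumℕ s (λ σ → c σ * c σ)

  sumSq≤sum*sum : ∀ s c → sumSq s c ≤ sumℕ s c * sumℕ s c
  sumSq≤sum*sum s c = begin
    sumℕ s (λ σ → c σ * c σ)       ≤⟨ sumℕ-mono-≤ s (λ σ → *-monoʳ-≤ (c σ) (term≤sumℕ s c σ)) ⟩
    sumℕ s (λ σ → c σ * sumℕ s c)  ≡⟨ sumℕ-*ʳ s (sumℕ s c) c ⟩
    sumℕ s c * sumℕ s c            ∎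
    where open ≤-Reasoning

  sumℕ≡0⇒sumSq≡0 : ∀ s c → sumℕ s c ≡ 0 → sumSq s c ≡ 0
  sumℕ≡0⇒sumSq≡0 s c Σc≡0 = n≤0⇒n≡0 (subst (λ x → sumSq s c ≤ x * x) Σc≡0 (sumSq≤sum*sum s c))

  module _ {s} {c c′ : Fin s → ℕ} (c′≤c : ∀ σ → c′ σ ≤ c σ) where

    private
      m  = sumℕ s c
      m′ = sumℕ s c′
      N  = sumSq s c
      N′ = sumSq s c′
      m′≤m = sumℕ-mono-≤ s c′≤c

    sumSq-mono-≤ : N′ ≤ N
    sumSq-mono-≤ = sumℕ-mono-≤ s (λ σ → *-mono-≤ (c′≤c σ) (c′≤c σ))

    sumSq≤sumSq+2*[m∸m′]*m : N ≤ N′ + 2 * (m ∸ m′) * m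
    sumSq≤sumSq+2*[m∸m′]*m = begin
      N                                                     ≤⟨ sumℕ-mono-≤ s (λ σ → m*m≤n*n+2*[m∸n]*o (c′≤c σ) (term≤sumℕ s c σ)) ⟩
      sumℕ s (λ σ → c′ σ * c′ σ + 2 * (c σ ∸ c′ σ) * m)    ≡⟨ sumℕ-+ s _ _ ⟩
      N′ + sumℕ s (λ σ → 2 * (c σ ∸ c′ σ) * m)             ≡⟨ cong (N′ +_) (sumℕ-*ʳ s m _) ⟩
      N′ + sumℕ s (λ σ → 2 * (c σ ∸ c′ σ)) * m             ≡⟨ cong (λ x → N′ + x * m) (sumℕ-*ˡ s 2 _) ⟩
      N′ + 2 * sumℕ s (λ σ → c σ ∸ c′ σ) * m               ≡⟨ cong (λ x → N′ + 2 * x * m) (sumℕ-∸ s c′≤c) ⟩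
      N′ + 2 * (m ∸ m′) * m                                 ∎
      where open ≤-Reasoning

    sumSq-shrink : N * m′ ≤ (N′ + 2 * (m ∸ m′) * m′) * m
    sumSq-shrink = begin
      N * m′                         ≤⟨ *-monoˡ-≤ m′ sumSq≤sumSq+2*[m∸m′]*m ⟩
      (N′ + E * m) * m′              ≡⟨ solve 4 (λ N′ E m m′ → (N′ :+ E :* m) :* m′ := N′ :* m′ :+ E :* m′ :* m) refl N′ E m m′ ⟩
      N′ * m′ + E * m′ * m           ≤⟨ +-monoˡ-≤ (E * m′ * m) (*-monoʳ-≤ N′ m′≤m) ⟩
      N′ * m + E * m′ * m            ≡⟨ *-distribʳ-+ m N′ (E * m′) ⟨
      (N′ + E * m′) * m              ∎
      where
      open ≤-Reasoning
      E = 2 * (m ∸ m′)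

    sumSq-grow : N′ * m ≤ (N + 2 * (m ∸ m′) * m) * m′
    sumSq-grow = begin
      N′ * m                         ≡⟨ cong (N′ *_) (m+[n∸m]≡n m′≤m) ⟨
      N′ * (m′ + d)                  ≡⟨ *-distribˡ-+ N′ m′ d ⟩
      N′ * m′ + N′ * d               ≤⟨ +-mono-≤ (*-monoˡ-≤ m′ sumSq-mono-≤) (*-monoˡ-≤ d (sumSq≤sum*sum s c′)) ⟩
      N * m′ + m′ * m′ * d           ≤⟨ +-monoʳ-≤ (N * m′) (*-monoˡ-≤ d (*-monoʳ-≤ m′ (≤-trans m′≤m (m≤n*m m 2)))) ⟩
      N * m′ + m′ * (2 * m) * d      ≡⟨ solve 4 (λ N m′ m d → N :* m′ :+ m′ :* (con 2 :* m) :* d := (N :+ con 2 :* d :* m) :* m′) refl N m′ m d ⟩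
      (N + 2 * d * m) * m′           ∎
      where
      open ≤-Reasoning
      d = m ∸ m′

open SumsOfSquares

module BinomialTwo where
  open import Data.Nat.Base
  open import Data.Nat.Properties
  open import Data.Nat.Combinatorics using (nCk+nC[k+1]≡[n+1]C[k+1]; nC1≡n)
  open import Data.Nat.Solver using (module +-*-Solver)
  open +-*-Solver

  2*[[1+n]C2]≡[1+n]*n : ∀ n → 2 * (suc n C 2) ≡ suc n * n
  2*[[1+n]C2]≡[1+n]*n zero    = refl
  2*[[1+n]C2]≡[1+n]*n (suc n) = begin
    2 * (suc (suc n) C 2)              ≡⟨ cong (2 *_) (nCk+nC[k+1]≡[n+1]C[k+1] (suc n) 1) ⟨
    2 * (suc n C 1 + suc n C 2)        ≡⟨ cong (λ x → 2 * (x + suc n C 2)) (nC1≡n (suc n)) ⟩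
    2 * (suc n + suc n C 2)            ≡⟨ *-distribˡ-+ 2 (suc n) _ ⟩
    2 * suc n + 2 * (suc n C 2)        ≡⟨ cong (2 * suc n +_) (2*[[1+n]C2]≡[1+n]*n n) ⟩
    2 * suc n + suc n * n              ≡⟨ solve 1 (λ n → con 2 :* (con 1 :+ n) :+ (con 1 :+ n) :* n := (con 2 :+ n) :* (con 1 :+ n)) refl n ⟩
    suc (suc n) * suc n                ∎
    where open ≡-Reasoning

  n*n≤4*[nC2] : ∀ n → 2 ≤ n → n * n ≤ 4 * (n C 2)
  n*n≤4*[nC2] (suc zero)    (s≤s ())
  n*n≤4*[nC2] (suc (suc n)) _ = begin
    (2 + n) * (2 + n)                  ≤⟨ *-monoʳ-≤ (2 + n) (+-monoʳ-≤ 2 (m≤n+m n n)) ⟩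
    (2 + n) * (2 + (n + n))            ≡⟨ solve 1 (λ n → (con 2 :+ n) :* (con 2 :+ (n :+ n)) := con 2 :* ((con 2 :+ n) :* (con 1 :+ n))) refl n ⟩
    2 * ((2 + n) * (1 + n))            ≡⟨ cong (2 *_) (2*[[1+n]C2]≡[1+n]*n (suc n)) ⟨
    2 * (2 * (suc (suc n) C 2))        ≡⟨ *-assoc 2 2 (suc (suc n) C 2) ⟨
    4 * (suc (suc n) C 2)              ∎
    where open ≤-Reasoning

open BinomialTwo

-- Blocks are indexed by all of ℕ (those of blocksOf P beyond k are empty), so that partitions
-- with different numbers of parts can be compared, and carry natural weights, so that
-- deleting the vertices of T stays inside the same type.
Blocks : ℕ → Set
Blocks n = ℕ → Fin n → ℕ

blocksOf : ∀ {n k} → Partition n k → Blocks n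
blocksOf P i v = 𝟙 (toℕ (P v) ℕₚ.≟ i)

outside inside : ∀ {n} → Subset n → Blocks n → Blocks n
outside T B i v = if lookup T v then 0 else B i v
inside  T B i v = if lookup T v then B i v else 0

module BlockSizes where
  open import Data.Nat.Base
  import Data.Vec.Properties as Vecₚ
  open import Data.Nat.Properties
  open import Data.Nat.Solver using (module +-*-Solver)
  open +-*-Solver

  blockSize : ∀ {n} → Blocks n → ℕ → ℕ
  blockSize {n} B i = sumℕ n (B i)

  sizeProduct : ∀ {n} → Blocks n → ℕ → ℕ → ℕ
  sizeProduct B i j = blockSize B i * blockSize B j

  sizeLoss : ∀ {n} → Blocks n → Blocks n → ℕ → ℕ
  sizeLoss B B′ K = sumℕ< K (λ i → sumℕ< K (λ j → 2 * (sizeProduct B i j ∸ sizeProduct B′ i j)))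

  blocksOf-vanish : ∀ {n k} (P : Partition n k) i → k ≤ i → ∀ v → blocksOf P i v ≡ 0
  blocksOf-vanish P i k≤i v = 𝟙-no (toℕ (P v) ≟ i) (λ Pv≡i → <-irrefl Pv≡i (<-≤-trans (Finₚ.toℕ<n (P v)) k≤i))

  sumℕ<-blocksOf : ∀ {n k K} (P : Partition n k) → k ≤ K → ∀ v → sumℕ< K (λ i → blocksOf P i v) ≡ 1
  sumℕ<-blocksOf {K = K} P k≤K v = sumℕ<-𝟙-≡ K (toℕ (P v)) (<-≤-trans (Finₚ.toℕ<n (P v)) k≤K)

  sumℕ<-blockSize-blocksOf : ∀ {n k K} (P : Partition n k) → k ≤ K →
                             sumℕ< K (blockSize (blocksOf P)) ≡ n
  sumℕ<-blockSize-blocksOf {n} {K = K} P k≤K = begin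
    sumℕ< K (λ i → sumℕ n (blocksOf P i))         ≡⟨ sumℕ-comm K n _ ⟩
    sumℕ n (λ v → sumℕ< K (λ i → blocksOf P i v))  ≡⟨ sumℕ-cong n (sumℕ<-blocksOf P k≤K) ⟩
    sumℕ n (λ _ → 1)                               ≡⟨ sumℕ-const-1 n ⟩
    n                                              ∎
    where open ≡-Reasoning

  ∣T∣≡sumℕ : ∀ {n} (T : Subset n) → Subset.∣ T ∣ ≡ sumℕ n (λ v → if lookup T v then 1 else 0)
  ∣T∣≡sumℕ []          = refl
  ∣T∣≡sumℕ (true ∷ T)  = cong suc (∣T∣≡sumℕ T)
  ∣T∣≡sumℕ (false ∷ T) = ∣T∣≡sumℕ T

  sumℕ<-blockSize-inside : ∀ {n k K} (P : Partition n k) (T : Subset n) → k ≤ K →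
                           sumℕ< K (blockSize (inside T (blocksOf P))) ≡ Subset.∣ T ∣
  sumℕ<-blockSize-inside {n} {K = K} P T k≤K = begin
    sumℕ< K (λ i → sumℕ n (inside T (blocksOf P) i))         ≡⟨ sumℕ-comm K n _ ⟩
    sumℕ n (λ v → sumℕ< K (λ i → inside T (blocksOf P) i v))  ≡⟨ sumℕ-cong n inside-column ⟩
    sumℕ n (λ v → if lookup T v then 1 else 0)                 ≡⟨ ∣T∣≡sumℕ T ⟨
    Subset.∣ T ∣                                                      ∎
    where
    open ≡-Reasoning
    inside-column : ∀ v → sumℕ< K (λ i → inside T (blocksOf P) i v) ≡ (if lookup T v then 1 else 0)
    inside-column v with lookup T v
    ... | true  = sumℕ<-blocksOf P k≤K v
    ... | false = sumℕ-const-0 K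

  outside-≤ : ∀ {n} (T : Subset n) B i v → outside T B i v ≤ B i v
  outside-≤ T B i v with lookup T v
  ... | true  = z≤n
  ... | false = ≤-refl

  blockSize-split : ∀ {n} (T : Subset n) B i → blockSize B i ≡ blockSize (outside T B) i + blockSize (inside T B) i
  blockSize-split {n} T B i = trans (sumℕ-cong n split) (sumℕ-+ n _ _)
    where
    split : ∀ v → B i v ≡ outside T B i v + inside T B i v
    split v with lookup T v
    ... | true  = refl
    ... | false = sym (+-identityʳ (B i v))

  [a+x]*[b+y]∸a*b≤ : ∀ a x b y → (a + x) * (b + y) ∸ a * b ≤ x * (b + y) + (a + x) * y
  [a+x]*[b+y]∸a*b≤ a x b y = begin
    (a + x) * (b + y) ∸ a * b
      ≡⟨ cong (_∸ a * b) (solve 4 (λ a x b y → (a :+ x) :* (b :+ y) := a :* b :+ (x :* (b :+ y) :+ a :* y)) refl a x b y) ⟩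
    a * b + (x * (b + y) + a * y) ∸ a * b            ≡⟨ m+n∸m≡n (a * b) _ ⟩
    x * (b + y) + a * y                              ≤⟨ +-monoʳ-≤ (x * (b + y)) (*-monoˡ-≤ y (m≤m+n a x)) ⟩
    x * (b + y) + (a + x) * y                        ∎
    where open ≤-Reasoning

  sizeProduct-outside-loss : ∀ {n} (T : Subset n) B i j →
    sizeProduct B i j ∸ sizeProduct (outside T B) i j ≤
    blockSize (inside T B) i * blockSize B j + blockSize B i * blockSize (inside T B) j
  sizeProduct-outside-loss T B i j
    rewrite blockSize-split T B i | blockSize-split T B j
    = [a+x]*[b+y]∸a*b≤ (blockSize (outside T B) i) (blockSize (inside T B) i)
                        (blockSize (outside T B) j) (blockSize (inside T B) j)

  sizeLoss-outside : ∀ {n k K} (P : Partition n k) (T : Subset n) → k ≤ K →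
                     sizeLoss (blocksOf P) (outside T (blocksOf P)) K ≤ 4 * (Subset.∣ T ∣ * n)
  sizeLoss-outside {n} {K = K} P T k≤K = begin
    sizeLoss S (outside T S) K
      ≤⟨ sumℕ-mono-≤ K (λ i → sumℕ-mono-≤ K (λ j → *-monoʳ-≤ 2 (sizeProduct-outside-loss T S (toℕ i) (toℕ j)))) ⟩
    sumℕ< K (λ i → sumℕ< K (λ j → 2 * (R i * Z j + Z i * R j)))
      ≡⟨ sumℕ-cong K (λ i → trans (sumℕ-*ˡ K 2 _) (cong (2 *_) (sumℕ-+ K _ _))) ⟩
    sumℕ< K (λ i → 2 * (sumℕ< K (λ j → R i * Z j) + sumℕ< K (λ j → Z i * R j)))
      ≡⟨ trans (sumℕ-*ˡ K 2 _) (cong (2 *_) (sumℕ-+ K _ _)) ⟩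
    2 * (sumℕ< K (λ i → sumℕ< K (λ j → R i * Z j)) + sumℕ< K (λ i → sumℕ< K (λ j → Z i * R j)))
      ≡⟨ cong (2 *_) (cong₂ _+_ (sumℕ-*-sumℕ K K _ _) (sumℕ-*-sumℕ K K _ _)) ⟩
    2 * (sumℕ< K R * sumℕ< K Z + sumℕ< K Z * sumℕ< K R)
      ≡⟨ cong₂ (λ r z → 2 * (r * z + z * r)) (sumℕ<-blockSize-inside P T k≤K) (sumℕ<-blockSize-blocksOf P k≤K) ⟩
    2 * (Subset.∣ T ∣ * n + n * Subset.∣ T ∣)
      ≡⟨ solve 2 (λ t n → con 2 :* (t :* n :+ n :* t) := con 4 :* (t :* n)) refl Subset.∣ T ∣ n ⟩
    4 * (Subset.∣ T ∣ * n) ∎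
    where
    open ≤-Reasoning
    S = blocksOf P
    R = blockSize (inside T S)
    Z = blockSize S

  outside-blocksOf-≡ : ∀ {n k l} (P : Partition n k) (Q : Partition n l) (T : Subset n) →
    (∀ (i : ℕ) (v : Fin n) → v ∉ T → (toℕ (P v) ≡ i ⇔ toℕ (Q v) ≡ i)) →
    ∀ i v → outside T (blocksOf P) i v ≡ outside T (blocksOf Q) i v
  outside-blocksOf-≡ P Q T P≈Q i v with lookup T v in T[v]≡b
  ... | true  = refl
  ... | false = 𝟙-cong (toℕ (P v) ≟ i) (toℕ (Q v) ≟ i) (Equivalence.to P≈Qv) (Equivalence.from P≈Qv)
    where
    v∉T : v ∉ T
    v∉T v∈T with trans (sym (Vecₚ.[]=⇒lookup v∈T)) T[v]≡b
    ... | ()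
    P≈Qv = P≈Q i v v∉T

open BlockSizes

module _ {n s : ℕ} (G : ColoredGraph n s) where
  open import Data.Nat.Base
  open import Data.Nat.Properties
  open ColoredGraph G

  colourCount : Blocks n → Fin s → ℕ → ℕ → ℕ
  colourCount B σ i j = sumℕ n (λ u → sumℕ n (λ w → B i u * B j w * 𝟙 (col u w Finₚ.≟ σ)))

  sumℕ-colourCount : ∀ B i j → sumℕ s (λ σ → colourCount B σ i j) ≡ sizeProduct B i j
  sumℕ-colourCount B i j = begin
    sumℕ s (λ σ → sumℕ n (λ u → sumℕ n (λ w → B i u * B j w * 𝟙 (col u w Finₚ.≟ σ))))
      ≡⟨ sumℕ-comm s n _ ⟩
    sumℕ n (λ u → sumℕ s (λ σ → sumℕ n (λ w → B i u * B j w * 𝟙 (col u w Finₚ.≟ σ))))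
      ≡⟨ sumℕ-cong n (λ u → sumℕ-comm s n _) ⟩
    sumℕ n (λ u → sumℕ n (λ w → sumℕ s (λ σ → B i u * B j w * 𝟙 (col u w Finₚ.≟ σ))))
      ≡⟨ sumℕ-cong n (λ u → sumℕ-cong n (λ w → one-colour u w)) ⟩
    sumℕ n (λ u → sumℕ n (λ w → B i u * B j w))
      ≡⟨ sumℕ-*-sumℕ n n (B i) (B j) ⟩
    sizeProduct B i j ∎
    where
    open ≡-Reasoning
    one-colour : ∀ u w → sumℕ s (λ σ → B i u * B j w * 𝟙 (col u w Finₚ.≟ σ)) ≡ B i u * B j w
    one-colour u w = trans (sumℕ-*ˡ s (B i u * B j w) _)
                           (trans (cong (B i u * B j w *_) (sumℕ-𝟙-≡ s (col u w))) (*-identityʳ _))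

  colourCount-mono-≤ : ∀ {B B′} → (∀ i v → B′ i v ≤ B i v) → ∀ σ i j → colourCount B′ σ i j ≤ colourCount B σ i j
  colourCount-mono-≤ B′≤B σ i j = sumℕ-mono-≤ n (λ u → sumℕ-mono-≤ n (λ w →
    *-monoˡ-≤ (𝟙 (col u w Finₚ.≟ σ)) (*-mono-≤ (B′≤B i u) (B′≤B j w))))

import Data.Integer.Base as ℤ
import Data.Integer.Properties as ℤₚ
open import Data.Rational using (ℚ; 0ℚ; 1ℚ; _+_; _*_; _≤_; _<_; _-_; -_; ∣_∣; toℚᵘ; nonNegative; positive)
import Data.Rational.Properties as ℚₚ
open import Data.Rational.Unnormalised.Base as ℚᵘ using (mkℚᵘ; *≡*; *≤*)
import Data.Rational.Unnormalised.Properties as ℚᵘₚ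
open import Data.Rational.Solver using (module +-*-Solver)

toℚᵘ-÷ℕ : ∀ a b → toℚᵘ (a ÷ℕ suc b) ℚᵘ.≃ mkℚᵘ (ℤ.+ a) b
toℚᵘ-÷ℕ a b = ℚₚ.toℚᵘ-fromℚᵘ (mkℚᵘ (ℤ.+ a) b)

÷ℕ-mono-≤ : ∀ a b c d → a ℕ.* suc d ℕ.≤ c ℕ.* suc b → a ÷ℕ suc b ≤ c ÷ℕ suc d
÷ℕ-mono-≤ a b c d ad≤cb = ℚₚ.toℚᵘ-cancel-≤
  (ℚᵘₚ.≤-respˡ-≃ (ℚᵘₚ.≃-sym (toℚᵘ-÷ℕ a b)) (ℚᵘₚ.≤-respʳ-≃ (ℚᵘₚ.≃-sym (toℚᵘ-÷ℕ c d))
    (*≤* (subst₂ ℤ._≤_ (ℤₚ.pos-* a (suc d)) (ℤₚ.pos-* c (suc b)) (ℤ.+≤+ ad≤cb)))))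

ℕ→ℚ-mono-≤ : ∀ {a b} → a ℕ.≤ b → ℕ→ℚ a ≤ ℕ→ℚ b
ℕ→ℚ-mono-≤ {a} {b} a≤b = ÷ℕ-mono-≤ a 0 b 0 (ℕₚ.*-monoˡ-≤ 1 a≤b)

÷ℕ-nonNeg : ∀ a b → 0ℚ ≤ a ÷ℕ b
÷ℕ-nonNeg a zero    = ℚₚ.≤-refl
÷ℕ-nonNeg a (suc b) = ÷ℕ-mono-≤ 0 0 a b ℕ.z≤n

ℕ→ℚ-nonNeg : ∀ a → 0ℚ ≤ ℕ→ℚ a
ℕ→ℚ-nonNeg a = ÷ℕ-nonNeg a 1

*-monoˡ-≤-0≤ : ∀ {r p q} → 0ℚ ≤ r → p ≤ q → r * p ≤ r * q
*-monoˡ-≤-0≤ {r} 0≤r = ℚₚ.*-monoˡ-≤-nonNeg r {{nonNegative 0≤r}}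

*-nonNeg : ∀ {p q} → 0ℚ ≤ p → 0ℚ ≤ q → 0ℚ ≤ p * q
*-nonNeg {p} {q} 0≤p 0≤q = subst (_≤ p * q) (ℚₚ.*-zeroʳ p) (*-monoˡ-≤-0≤ 0≤p 0≤q)

∣x-y∣≤z : ∀ {x y z} → x ≤ y + z → y ≤ x + z → ∣ x - y ∣ ≤ z
∣x-y∣≤z {x} {y} {z} x≤y+z y≤x+z with ℚₚ.∣p∣≡p∨∣p∣≡-p (x - y)
... | inj₁ ∣x-y∣≡x-y = subst₂ _≤_ (sym ∣x-y∣≡x-y) (solve 2 (λ y z → y :+ z :- y := z) refl y z)
                               (ℚₚ.+-monoˡ-≤ (- y) x≤y+z)
  where open +-*-Solver
... | inj₂ ∣x-y∣≡y-x = subst₂ _≤_ (trans (solve 2 (λ x y → y :- x := :- (x :- y)) refl x y) (sym ∣x-y∣≡y-x))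
                               (solve 2 (λ x z → x :+ z :- x := z) refl x z)
                               (ℚₚ.+-monoˡ-≤ (- x) y≤x+z)
  where open +-*-Solver

module _ where
  open ℚᵘₚ.≃-Reasoning

  ℕ→ℚ-+ : ∀ a b → ℕ→ℚ (a ℕ.+ b) ≡ ℕ→ℚ a + ℕ→ℚ b
  ℕ→ℚ-+ a b = ℚₚ.toℚᵘ-injective (begin
    toℚᵘ (ℕ→ℚ (a ℕ.+ b))             ≈⟨ toℚᵘ-÷ℕ (a ℕ.+ b) 0 ⟩
    mkℚᵘ (ℤ.+ (a ℕ.+ b)) 0              ≈⟨ *≡* (cong (ℤ._* ℤ.+ 1) (trans (ℤₚ.pos-+ a b)
                                           (sym (cong₂ ℤ._+_ (ℤₚ.*-identityʳ (ℤ.+ a)) (ℤₚ.*-identityʳ (ℤ.+ b)))))) ⟩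
    mkℚᵘ (ℤ.+ a) 0 ℚᵘ.+ mkℚᵘ (ℤ.+ b) 0    ≈⟨ ℚᵘₚ.+-cong (toℚᵘ-÷ℕ a 0) (toℚᵘ-÷ℕ b 0) ⟨
    toℚᵘ (ℕ→ℚ a) ℚᵘ.+ toℚᵘ (ℕ→ℚ b)    ≈⟨ ℚₚ.toℚᵘ-homo-+ (ℕ→ℚ a) (ℕ→ℚ b) ⟨
    toℚᵘ (ℕ→ℚ a + ℕ→ℚ b)             ∎)

  ℕ→ℚ-* : ∀ a b → ℕ→ℚ (a ℕ.* b) ≡ ℕ→ℚ a * ℕ→ℚ b
  ℕ→ℚ-* a b = ℚₚ.toℚᵘ-injective (begin
    toℚᵘ (ℕ→ℚ (a ℕ.* b))             ≈⟨ toℚᵘ-÷ℕ (a ℕ.* b) 0 ⟩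
    mkℚᵘ (ℤ.+ (a ℕ.* b)) 0              ≈⟨ *≡* (cong (ℤ._* ℤ.+ 1) (ℤₚ.pos-* a b)) ⟩
    mkℚᵘ (ℤ.+ a) 0 ℚᵘ.* mkℚᵘ (ℤ.+ b) 0    ≈⟨ ℚᵘₚ.*-cong (toℚᵘ-÷ℕ a 0) (toℚᵘ-÷ℕ b 0) ⟨
    toℚᵘ (ℕ→ℚ a) ℚᵘ.* toℚᵘ (ℕ→ℚ b)    ≈⟨ ℚₚ.toℚᵘ-homo-* (ℕ→ℚ a) (ℕ→ℚ b) ⟨
    toℚᵘ (ℕ→ℚ a * ℕ→ℚ b)             ∎)

  ÷ℕ≡ℕ→ℚ*1÷ℕ : ∀ a b → a ÷ℕ b ≡ ℕ→ℚ a * (1 ÷ℕ b)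
  ÷ℕ≡ℕ→ℚ*1÷ℕ a zero    = sym (ℚₚ.*-zeroʳ (ℕ→ℚ a))
  ÷ℕ≡ℕ→ℚ*1÷ℕ a (suc b) = ℚₚ.toℚᵘ-injective (begin
    toℚᵘ (a ÷ℕ suc b)                    ≈⟨ toℚᵘ-÷ℕ a b ⟩
    mkℚᵘ (ℤ.+ a) b                          ≈⟨ *≡* (cong₂ ℤ._*_ (sym (ℤₚ.*-identityʳ (ℤ.+ a))) (cong ℤ.+_ (ℕₚ.*-identityˡ (suc b)))) ⟩
    mkℚᵘ (ℤ.+ a) 0 ℚᵘ.* mkℚᵘ (ℤ.+ 1) b        ≈⟨ ℚᵘₚ.*-cong (toℚᵘ-÷ℕ a 0) (toℚᵘ-÷ℕ 1 b) ⟨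
    toℚᵘ (ℕ→ℚ a) ℚᵘ.* toℚᵘ (1 ÷ℕ suc b)  ≈⟨ ℚₚ.toℚᵘ-homo-* (ℕ→ℚ a) (1 ÷ℕ suc b) ⟨
    toℚᵘ (ℕ→ℚ a * (1 ÷ℕ suc b))          ∎)

  ℕ→ℚ*1÷ℕ≡1 : ∀ b → ℕ→ℚ (suc b) * (1 ÷ℕ suc b) ≡ 1ℚ
  ℕ→ℚ*1÷ℕ≡1 b = ℚₚ.toℚᵘ-injective (begin
    toℚᵘ (ℕ→ℚ (suc b) * (1 ÷ℕ suc b))           ≈⟨ ℚₚ.toℚᵘ-homo-* (ℕ→ℚ (suc b)) (1 ÷ℕ suc b) ⟩
    toℚᵘ (ℕ→ℚ (suc b)) ℚᵘ.* toℚᵘ (1 ÷ℕ suc b)   ≈⟨ ℚᵘₚ.*-cong (toℚᵘ-÷ℕ (suc b) 0) (toℚᵘ-÷ℕ 1 b) ⟩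
    mkℚᵘ (ℤ.+ suc b) 0 ℚᵘ.* mkℚᵘ (ℤ.+ 1) b           ≈⟨ *≡* (trans (ℤₚ.*-identityʳ _) (trans (ℤₚ.*-identityʳ _)
                                                      (trans (cong ℤ.+_ (sym (ℕₚ.*-identityˡ (suc b)))) (sym (ℤₚ.*-identityˡ _))))) ⟩
    mkℚᵘ (ℤ.+ 1) 0                                 ∎)

module RationalSums where
  open import Algebra.Bundles using (CommutativeRing)
  import Algebra.Properties.Semiring.Sum (CommutativeRing.semiring ℚₚ.+-*-commutativeRing) as ∑

  sumℚ≡sum : ∀ m (f : Fin m → ℚ) → sumℚ m f ≡ ∑.sum f
  sumℚ≡sum zero    f = refl
  sumℚ≡sum (suc m) f = cong (f Fz +_) (sumℚ≡sum m (f ∘ Fs))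

  sumℚ-cong : ∀ m {f g : Fin m → ℚ} → (∀ i → f i ≡ g i) → sumℚ m f ≡ sumℚ m g
  sumℚ-cong zero    f≡g = refl
  sumℚ-cong (suc m) f≡g = cong₂ _+_ (f≡g Fz) (sumℚ-cong m (f≡g ∘ Fs))

  sumℚ-mono-≤ : ∀ m {f g : Fin m → ℚ} → (∀ i → f i ≤ g i) → sumℚ m f ≤ sumℚ m g
  sumℚ-mono-≤ zero    f≤g = ℚₚ.≤-refl
  sumℚ-mono-≤ (suc m) f≤g = ℚₚ.+-mono-≤ (f≤g Fz) (sumℚ-mono-≤ m (f≤g ∘ Fs))

  sumℚ-zero : ∀ m {f : Fin m → ℚ} → (∀ i → f i ≡ 0ℚ) → sumℚ m f ≡ 0ℚ
  sumℚ-zero zero    f≡0 = refl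
  sumℚ-zero (suc m) f≡0 = cong₂ _+_ (f≡0 Fz) (sumℚ-zero m (f≡0 ∘ Fs))

  sumℚ-+ : ∀ m (f g : Fin m → ℚ) → sumℚ m (λ i → f i + g i) ≡ sumℚ m f + sumℚ m g
  sumℚ-+ m f g = begin
    sumℚ m (λ i → f i + g i)  ≡⟨ sumℚ≡sum m _ ⟩
    ∑.sum (λ i → f i + g i)   ≡⟨ ∑.∑-distrib-+ f g ⟩
    ∑.sum f + ∑.sum g         ≡⟨ cong₂ _+_ (sumℚ≡sum m f) (sumℚ≡sum m g) ⟨
    sumℚ m f + sumℚ m g       ∎
    where open ≡-Reasoning

  sumℚ-*ˡ : ∀ m c (f : Fin m → ℚ) → sumℚ m (λ i → c * f i) ≡ c * sumℚ m f
  sumℚ-*ˡ m c f = begin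
    sumℚ m (λ i → c * f i)  ≡⟨ sumℚ≡sum m _ ⟩
    ∑.sum (λ i → c * f i)   ≡⟨ ∑.*-distribˡ-sum c f ⟨
    c * ∑.sum f             ≡⟨ cong (c *_) (sumℚ≡sum m f) ⟨
    c * sumℚ m f            ∎
    where open ≡-Reasoning

  ℕ→ℚ-sumℕ : ∀ m (f : Fin m → ℕ) → ℕ→ℚ (sumℕ m f) ≡ sumℚ m (ℕ→ℚ ∘ f)
  ℕ→ℚ-sumℕ zero    f = refl
  ℕ→ℚ-sumℕ (suc m) f = trans (ℕ→ℚ-+ (f Fz) _) (cong (ℕ→ℚ (f Fz) +_) (ℕ→ℚ-sumℕ m (f ∘ Fs)))

  sumℚ-≤-+ℕ→ℚ : ∀ m {f g : Fin m → ℚ} (e : Fin m → ℕ) → (∀ i → f i ≤ g i + ℕ→ℚ (e i)) →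
                sumℚ m f ≤ sumℚ m g + ℕ→ℚ (sumℕ m e)
  sumℚ-≤-+ℕ→ℚ m {f} {g} e f≤g+e = begin
    sumℚ m f                                  ≤⟨ sumℚ-mono-≤ m f≤g+e ⟩
    sumℚ m (λ i → g i + ℕ→ℚ (e i))            ≡⟨ sumℚ-+ m g _ ⟩
    sumℚ m g + sumℚ m (ℕ→ℚ ∘ e)               ≡⟨ cong (sumℚ m g +_) (ℕ→ℚ-sumℕ m e) ⟨
    sumℚ m g + ℕ→ℚ (sumℕ m e)                 ∎
    where open ℚₚ.≤-Reasoning

  sumℚ< : ℕ → (ℕ → ℚ) → ℚ
  sumℚ< K f = sumℚ K (f ∘ toℕ)

  sumℚ<-extend : ∀ K d (h : ℕ → ℚ) → (∀ i → K ℕ.≤ i → h i ≡ 0ℚ) → sumℚ< (K ℕ.+ d) h ≡ sumℚ< K h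
  sumℚ<-extend zero    d h h≡0 = sumℚ-zero d (λ i → h≡0 (toℕ i) ℕ.z≤n)
  sumℚ<-extend (suc K) d h h≡0 = cong (h 0 +_) (sumℚ<-extend K d (h ∘ suc) (λ i K≤i → h≡0 (suc i) (ℕ.s≤s K≤i)))

open RationalSums

÷ℕ-+-ℕ→ℚ : ∀ c d e → (c ℕ.+ e ℕ.* suc d) ÷ℕ suc d ≡ c ÷ℕ suc d + ℕ→ℚ e
÷ℕ-+-ℕ→ℚ c d e = begin
  (c ℕ.+ e ℕ.* suc d) ÷ℕ suc d         ≡⟨ ÷ℕ≡ℕ→ℚ*1÷ℕ (c ℕ.+ e ℕ.* suc d) (suc d) ⟩
  ℕ→ℚ (c ℕ.+ e ℕ.* suc d) * Y          ≡⟨ cong (_* Y) (trans (ℕ→ℚ-+ c _) (cong (ℕ→ℚ c +_) (ℕ→ℚ-* e (suc d)))) ⟩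
  (ℕ→ℚ c + ℕ→ℚ e * D) * Y              ≡⟨ solve 4 (λ C E D Y → (C :+ E :* D) :* Y := C :* Y :+ E :* (D :* Y)) refl (ℕ→ℚ c) (ℕ→ℚ e) D Y ⟩
  ℕ→ℚ c * Y + ℕ→ℚ e * (D * Y)          ≡⟨ cong₂ _+_ (sym (÷ℕ≡ℕ→ℚ*1÷ℕ c (suc d))) (cong (ℕ→ℚ e *_) (ℕ→ℚ*1÷ℕ≡1 d)) ⟩
  c ÷ℕ suc d + ℕ→ℚ e * 1ℚ              ≡⟨ cong (c ÷ℕ suc d +_) (ℚₚ.*-identityʳ (ℕ→ℚ e)) ⟩
  c ÷ℕ suc d + ℕ→ℚ e                   ∎
  where
  open +-*-Solver
  open ≡-Reasoning
  D = ℕ→ℚ (suc d)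
  Y = 1 ÷ℕ suc d

-- The first hypothesis takes care of the junk value c ÷ℕ 0 = 0.
÷ℕ≤÷ℕ+ℕ→ℚ : ∀ a b c d e → (d ≡ 0 → a ℕ.≤ e ℕ.* b) → a ℕ.* d ℕ.≤ (c ℕ.+ e ℕ.* d) ℕ.* b →
            a ÷ℕ b ≤ c ÷ℕ d + ℕ→ℚ e
÷ℕ≤÷ℕ+ℕ→ℚ a zero c d e _ _ = ℚₚ.+-mono-≤ (÷ℕ-nonNeg c d) (ℕ→ℚ-nonNeg e)
÷ℕ≤÷ℕ+ℕ→ℚ a (suc b) c zero e d≡0⇒a≤eb _ =
  subst (a ÷ℕ suc b ≤_) (sym (ℚₚ.+-identityˡ (ℕ→ℚ e)))
    (÷ℕ-mono-≤ a b e 0 (subst (ℕ._≤ e ℕ.* suc b) (sym (ℕₚ.*-identityʳ a)) (d≡0⇒a≤eb refl)))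
÷ℕ≤÷ℕ+ℕ→ℚ a (suc b) c (suc d) e _ ad≤[c+ed]b =
  ℚₚ.≤-trans (÷ℕ-mono-≤ a b (c ℕ.+ e ℕ.* suc d) d ad≤[c+ed]b) (ℚₚ.≤-reflexive (÷ℕ-+-ℕ→ℚ c d e))

sqMean : (s : ℕ) → (Fin s → ℕ) → ℚ
sqMean s c = sumSq s c ÷ℕ sumℕ s c

module _ {s} {c c′ : Fin s → ℕ} (c′≤c : ∀ σ → c′ σ ℕ.≤ c σ) where

  private
    m  = sumℕ s c
    m′ = sumℕ s c′
    E  = 2 ℕ.* (m ℕ.∸ m′)

  sqMean-shrink : sqMean s c ≤ sqMean s c′ + ℕ→ℚ (2 ℕ.* (sumℕ s c ℕ.∸ sumℕ s c′))
  sqMean-shrink = ÷ℕ≤÷ℕ+ℕ→ℚ (sumSq s c) m (sumSq s c′) m′ E m′≡0⇒ (sumSq-shrink c′≤c)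
    where
    m′≡0⇒ : m′ ≡ 0 → sumSq s c ℕ.≤ E ℕ.* m
    m′≡0⇒ m′≡0 = subst (λ N′ → sumSq s c ℕ.≤ N′ ℕ.+ E ℕ.* m) (sumℕ≡0⇒sumSq≡0 s c′ m′≡0) (sumSq≤sumSq+2*[m∸m′]*m c′≤c)

  sqMean-grow : sqMean s c′ ≤ sqMean s c + ℕ→ℚ (2 ℕ.* (sumℕ s c ℕ.∸ sumℕ s c′))
  sqMean-grow = ÷ℕ≤÷ℕ+ℕ→ℚ (sumSq s c′) m′ (sumSq s c) m E m≡0⇒ (sumSq-grow c′≤c)
    where
    m≡0⇒ : m ≡ 0 → sumSq s c′ ℕ.≤ E ℕ.* m′
    m≡0⇒ m≡0 = subst (ℕ._≤ E ℕ.* m′) (sym (sumℕ≡0⇒sumSq≡0 s c′ m′≡0)) ℕ.z≤n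
      where
      m′≡0 : m′ ≡ 0
      m′≡0 = ℕₚ.n≤0⇒n≡0 (subst (m′ ℕ.≤_) m≡0 (sumℕ-mono-≤ s c′≤c))

𝟙*-≤ : ∀ {A : Set} (a? : Dec A) {x y} e → x ≤ y + ℕ→ℚ e → ℕ→ℚ (𝟙 a?) * x ≤ ℕ→ℚ (𝟙 a?) * y + ℕ→ℚ e
𝟙*-≤ (yes _) {x} {y} e x≤y+e = subst₂ _≤_ (sym (ℚₚ.*-identityˡ x)) (cong (_+ ℕ→ℚ e) (sym (ℚₚ.*-identityˡ y))) x≤y+e
𝟙*-≤ (no _)  {x} {y} e _     = subst₂ _≤_ (sym (ℚₚ.*-zeroˡ x)) (cong (_+ ℕ→ℚ e) (sym (ℚₚ.*-zeroˡ y)))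
                                 (ℚₚ.+-mono-≤ (ℚₚ.≤-refl {0ℚ}) (ℕ→ℚ-nonNeg e))

[M÷C]*∑[c÷M]²≡[1÷C]*sqMean : ∀ M C s (c : Fin s → ℕ) → sumℕ s c ≡ M →
  (M ÷ℕ C) * sumℚ s (λ σ → (c σ ÷ℕ M) * (c σ ÷ℕ M)) ≡ 1 ÷ℕ C * sqMean s c
[M÷C]*∑[c÷M]²≡[1÷C]*sqMean M C s c Σc≡M = begin
  (M ÷ℕ C) * sumℚ s (λ σ → (c σ ÷ℕ M) * (c σ ÷ℕ M))
    ≡⟨ cong₂ _*_ (÷ℕ≡ℕ→ℚ*1÷ℕ M C) (sumℚ-cong s (λ σ → cong₂ _*_ (÷ℕ≡ℕ→ℚ*1÷ℕ (c σ) M) (÷ℕ≡ℕ→ℚ*1÷ℕ (c σ) M))) ⟩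
  ℕ→ℚ M * Y * sumℚ s (λ σ → ℕ→ℚ (c σ) * X * (ℕ→ℚ (c σ) * X))
    ≡⟨ cong (ℕ→ℚ M * Y *_) (sumℚ-cong s (λ σ → solve 2 (λ a x → a :* x :* (a :* x) := (x :* x) :* (a :* a)) refl (ℕ→ℚ (c σ)) X)) ⟩
  ℕ→ℚ M * Y * sumℚ s (λ σ → X * X * (ℕ→ℚ (c σ) * ℕ→ℚ (c σ)))
    ≡⟨ cong (ℕ→ℚ M * Y *_) (trans (sumℚ-*ˡ s (X * X) _) (cong (X * X *_) (sumℚ-cong s (λ σ → sym (ℕ→ℚ-* (c σ) (c σ)))))) ⟩
  ℕ→ℚ M * Y * (X * X * sumℚ s (λ σ → ℕ→ℚ (c σ ℕ.* c σ)))
    ≡⟨ cong (λ x → ℕ→ℚ M * Y * (X * X * x)) (sym (ℕ→ℚ-sumℕ s _)) ⟩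
  ℕ→ℚ M * Y * (X * X * N)
    ≡⟨ solve 4 (λ M Y X N → M :* Y :* (X :* X :* N) := Y :* (N :* (M :* X :* X))) refl (ℕ→ℚ M) Y X N ⟩
  Y * (N * (ℕ→ℚ M * X * X))
    ≡⟨ cong (λ x → Y * (N * x)) (M*X*X≡X M) ⟩
  Y * (N * X)
    ≡⟨ cong (Y *_) (sym (÷ℕ≡ℕ→ℚ*1÷ℕ (sumSq s c) M)) ⟩
  Y * (sumSq s c ÷ℕ M)
    ≡⟨ cong (λ x → Y * (sumSq s c ÷ℕ x)) (sym Σc≡M) ⟩
  Y * sqMean s c ∎
  where
  open ≡-Reasoning
  open +-*-Solver
  X = 1 ÷ℕ M
  Y = 1 ÷ℕ C
  N = ℕ→ℚ (sumSq s c)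
  M*X*X≡X : ∀ M → ℕ→ℚ M * (1 ÷ℕ M) * (1 ÷ℕ M) ≡ 1 ÷ℕ M
  M*X*X≡X zero    = ℚₚ.*-zeroʳ (ℕ→ℚ 0 * 0ℚ)
  M*X*X≡X (suc M) = trans (cong (_* (1 ÷ℕ suc M)) (ℕ→ℚ*1÷ℕ≡1 M)) (ℚₚ.*-identityˡ _)

module Potential {n s : ℕ} (G : ColoredGraph n s) where
  open ColoredGraph G using (col)

  -- For the blocks of a partition, pairTerm is |V_i||V_j|·ind(V_i,V_j) (restricted to i < j)
  -- and potential is C(n,2)·ind(P); see ind≡potential.
  pairTerm : Blocks n → ℕ → ℕ → ℚ
  pairTerm B i j = ℕ→ℚ (𝟙 (i ℕₚ.<? j)) * sqMean s (λ σ → colourCount G B σ i j)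

  potential : Blocks n → ℕ → ℚ
  potential B K = sumℚ< K (λ i → sumℚ< K (pairTerm B i))

  potential-cong : ∀ {B B′} → (∀ i v → B i v ≡ B′ i v) → ∀ K → potential B K ≡ potential B′ K
  potential-cong {B} {B′} B≡B′ K = sumℚ-cong K (λ i → sumℚ-cong K (λ j → pairTerm-cong (toℕ i) (toℕ j)))
    where
    colourCount-cong : ∀ σ i j → colourCount G B σ i j ≡ colourCount G B′ σ i j
    colourCount-cong σ i j = sumℕ-cong n (λ u → sumℕ-cong n (λ w →
      cong₂ (λ x y → x ℕ.* y ℕ.* 𝟙 (col u w Finₚ.≟ σ)) (B≡B′ i u) (B≡B′ j w)))
    pairTerm-cong : ∀ i j → pairTerm B i j ≡ pairTerm B′ i j
    pairTerm-cong i j = cong₂ (λ N M → ℕ→ℚ (𝟙 (i ℕₚ.<? j)) * (N ÷ℕ M))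
      (sumℕ-cong s (λ σ → cong₂ ℕ._*_ (colourCount-cong σ i j) (colourCount-cong σ i j)))
      (sumℕ-cong s (λ σ → colourCount-cong σ i j))

  pairTerm-vanish : ∀ B i j → sizeProduct B i j ≡ 0 → pairTerm B i j ≡ 0ℚ
  pairTerm-vanish B i j size≡0 =
    trans (cong (λ M → ℕ→ℚ (𝟙 (i ℕₚ.<? j)) * (sumSq s (λ σ → colourCount G B σ i j) ÷ℕ M))
                (trans (sumℕ-colourCount G B i j) size≡0))
          (ℚₚ.*-zeroʳ (ℕ→ℚ (𝟙 (i ℕₚ.<? j))))

  potential-extend : ∀ B K d → (∀ i → K ℕ.≤ i → ∀ v → B i v ≡ 0) → potential B (K ℕ.+ d) ≡ potential B K
  potential-extend B K d B≡0 = begin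
    sumℚ< (K ℕ.+ d) (λ i → sumℚ< (K ℕ.+ d) (pairTerm B i))
      ≡⟨ sumℚ-cong (K ℕ.+ d) (λ i → sumℚ<-extend K d (pairTerm B (toℕ i))
           (λ j K≤j → pairTerm-vanish B (toℕ i) j (trans (cong (blockSize B (toℕ i) ℕ.*_) (size≡0 j K≤j)) (ℕₚ.*-zeroʳ (blockSize B (toℕ i)))))) ⟩
    sumℚ< (K ℕ.+ d) (λ i → sumℚ< K (pairTerm B i))
      ≡⟨ sumℚ<-extend K d _ (λ i K≤i → sumℚ-zero K (λ j → pairTerm-vanish B i (toℕ j) (cong (ℕ._* blockSize B (toℕ j)) (size≡0 i K≤i)))) ⟩
    sumℚ< K (λ i → sumℚ< K (pairTerm B i)) ∎
    where
    open ≡-Reasoning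
    size≡0 : ∀ i → K ℕ.≤ i → blockSize B i ≡ 0
    size≡0 i K≤i = trans (sumℕ-cong n (B≡0 i K≤i)) (sumℕ-const-0 n)

  module _ {k} (P : Partition n k) where

    size≡blockSize : ∀ i → size G P i ≡ blockSize (blocksOf P) (toℕ i)
    size≡blockSize i = sumℕ-cong n (λ v → 𝟙-cong (P v Finₚ.≟ i) (toℕ (P v) ℕₚ.≟ toℕ i) (cong toℕ) Finₚ.toℕ-injective)

    count≡colourCount : ∀ σ i i′ → count G P σ i i′ ≡ colourCount G (blocksOf P) σ (toℕ i) (toℕ i′)
    count≡colourCount σ i i′ = sumℕ-cong n (λ u → sumℕ-cong n (λ w →
      cong₂ (λ x y → x ℕ.* y ℕ.* 𝟙 (col u w Finₚ.≟ σ))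
        (𝟙-cong (P u Finₚ.≟ i) (toℕ (P u) ℕₚ.≟ toℕ i) (cong toℕ) Finₚ.toℕ-injective)
        (𝟙-cong (P w Finₚ.≟ i′) (toℕ (P w) ℕₚ.≟ toℕ i′) (cong toℕ) Finₚ.toℕ-injective)))

    ind≡potential-blocksOf : ind G P ≡ 1 ÷ℕ (n C 2) * potential (blocksOf P) k
    ind≡potential-blocksOf = begin
      ind G P
        ≡⟨ sumℚ-cong k (λ i → sumℚ-cong k (λ i′ → term≡ i i′)) ⟩
      sumℚ k (λ i → sumℚ k (λ i′ → Y * pairTerm B (toℕ i) (toℕ i′)))
        ≡⟨ sumℚ-cong k (λ i → sumℚ-*ˡ k Y _) ⟩
      sumℚ k (λ i → Y * sumℚ k (λ i′ → pairTerm B (toℕ i) (toℕ i′)))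
        ≡⟨ sumℚ-*ˡ k Y _ ⟩
      Y * potential B k ∎
      where
      open ≡-Reasoning
      B = blocksOf P
      pairs = n C 2
      Y = 1 ÷ℕ pairs
      term≡ : ∀ i i′ → ℕ→ℚ (𝟙 (toℕ i ℕₚ.<? toℕ i′)) * ((size G P i ℕ.* size G P i′) ÷ℕ pairs) * indPair G P i i′
                       ≡ Y * pairTerm B (toℕ i) (toℕ i′)
      term≡ i i′ = begin
        b * (M ÷ℕ pairs) * sumℚ s (λ σ → (count G P σ i i′ ÷ℕ M) * (count G P σ i i′ ÷ℕ M))
          ≡⟨ ℚₚ.*-assoc b _ _ ⟩
        b * ((M ÷ℕ pairs) * sumℚ s (λ σ → (count G P σ i i′ ÷ℕ M) * (count G P σ i i′ ÷ℕ M)))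
          ≡⟨ cong (b *_) (cong₂ (λ M x → (M ÷ℕ pairs) * x) M≡M′ (sumℚ-cong s (λ σ →
               cong₂ (λ M c → (c ÷ℕ M) * (c ÷ℕ M)) M≡M′ (count≡colourCount σ i i′)))) ⟩
        b * ((M′ ÷ℕ pairs) * sumℚ s (λ σ → (c σ ÷ℕ M′) * (c σ ÷ℕ M′)))
          ≡⟨ cong (b *_) ([M÷C]*∑[c÷M]²≡[1÷C]*sqMean M′ pairs s c (sumℕ-colourCount G B (toℕ i) (toℕ i′))) ⟩
        b * (Y * sqMean s c)
          ≡⟨ solve 3 (λ b Y x → b :* (Y :* x) := Y :* (b :* x)) refl b Y (sqMean s c) ⟩
        Y * pairTerm B (toℕ i) (toℕ i′) ∎
        where
        open +-*-Solver
        b = ℕ→ℚ (𝟙 (toℕ i ℕₚ.<? toℕ i′))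
        M = size G P i ℕ.* size G P i′
        M′ = sizeProduct B (toℕ i) (toℕ i′)
        M≡M′ : M ≡ M′
        M≡M′ = cong₂ ℕ._*_ (size≡blockSize i) (size≡blockSize i′)
        c : Fin s → ℕ
        c σ = colourCount G B σ (toℕ i) (toℕ i′)

    ind≡potential : ∀ {K} → k ℕ.≤ K → ind G P ≡ 1 ÷ℕ (n C 2) * potential (blocksOf P) K
    ind≡potential {K} k≤K = begin
      ind G P                                                   ≡⟨ ind≡potential-blocksOf ⟩
      1 ÷ℕ (n C 2) * potential (blocksOf P) k                   ≡⟨ cong (1 ÷ℕ (n C 2) *_) (potential-extend (blocksOf P) k (K ℕ.∸ k) (blocksOf-vanish P)) ⟨
      1 ÷ℕ (n C 2) * potential (blocksOf P) (k ℕ.+ (K ℕ.∸ k))   ≡⟨ cong (λ K → 1 ÷ℕ (n C 2) * potential (blocksOf P) K) (ℕₚ.m+[n∸m]≡n k≤K) ⟩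
      1 ÷ℕ (n C 2) * potential (blocksOf P) K                   ∎
      where open ≡-Reasoning

  module _ {B B′ : Blocks n} (B′≤B : ∀ i v → B′ i v ℕ.≤ B i v) where

    private
      loss : ℕ → ℕ → ℕ
      loss i j = 2 ℕ.* (sizeProduct B i j ℕ.∸ sizeProduct B′ i j)

      loss≡ : ∀ i j → 2 ℕ.* (sumℕ s (λ σ → colourCount G B σ i j) ℕ.∸ sumℕ s (λ σ → colourCount G B′ σ i j)) ≡ loss i j
      loss≡ i j = cong₂ (λ x y → 2 ℕ.* (x ℕ.∸ y)) (sumℕ-colourCount G B i j) (sumℕ-colourCount G B′ i j)

    pairTerm-shrink : ∀ i j → pairTerm B i j ≤ pairTerm B′ i j + ℕ→ℚ (loss i j)
    pairTerm-shrink i j = 𝟙*-≤ (i ℕₚ.<? j) (loss i j)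
      (subst (λ e → sqMean s (λ σ → colourCount G B σ i j) ≤ sqMean s (λ σ → colourCount G B′ σ i j) + ℕ→ℚ e)
             (loss≡ i j) (sqMean-shrink (λ σ → colourCount-mono-≤ G B′≤B σ i j)))

    pairTerm-grow : ∀ i j → pairTerm B′ i j ≤ pairTerm B i j + ℕ→ℚ (loss i j)
    pairTerm-grow i j = 𝟙*-≤ (i ℕₚ.<? j) (loss i j)
      (subst (λ e → sqMean s (λ σ → colourCount G B′ σ i j) ≤ sqMean s (λ σ → colourCount G B σ i j) + ℕ→ℚ e)
             (loss≡ i j) (sqMean-grow (λ σ → colourCount-mono-≤ G B′≤B σ i j)))

    potential-shrink : ∀ K → potential B K ≤ potential B′ K + ℕ→ℚ (sizeLoss B B′ K)
    potential-shrink K = sumℚ-≤-+ℕ→ℚ K (λ i → sumℕ< K (loss (toℕ i)))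
      (λ i → sumℚ-≤-+ℕ→ℚ K (loss (toℕ i) ∘ toℕ) (λ j → pairTerm-shrink (toℕ i) (toℕ j)))

    potential-grow : ∀ K → potential B′ K ≤ potential B K + ℕ→ℚ (sizeLoss B B′ K)
    potential-grow K = sumℚ-≤-+ℕ→ℚ K (λ i → sumℕ< K (loss (toℕ i)))
      (λ i → sumℚ-≤-+ℕ→ℚ K (loss (toℕ i) ∘ toℕ) (λ j → pairTerm-grow (toℕ i) (toℕ j)))

  ind-close : ∀ {k l} (P : Partition n k) (Q : Partition n l) (T : Subset n) →
    (∀ (i : ℕ) (v : Fin n) → v ∉ T → (toℕ (P v) ≡ i ⇔ toℕ (Q v) ≡ i)) →
    ind G P ≤ ind G Q + 1 ÷ℕ (n C 2) * ℕ→ℚ (8 ℕ.* (Subset.∣ T ∣ ℕ.* n))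
  ind-close {k} {l} P Q T P≈Q = begin
    ind G P                                ≡⟨ ind≡potential P (ℕₚ.m≤m+n k l) ⟩
    Y * potential SP K                     ≤⟨ *-monoˡ-≤-0≤ (÷ℕ-nonNeg 1 (n C 2)) potentialP≤ ⟩
    Y * (potential SQ K + ℕ→ℚ e8)          ≡⟨ ℚₚ.*-distribˡ-+ Y _ _ ⟩
    Y * potential SQ K + Y * ℕ→ℚ e8        ≡⟨ cong (_+ Y * ℕ→ℚ e8) (ind≡potential Q (ℕₚ.m≤n+m l k)) ⟨
    ind G Q + Y * ℕ→ℚ e8                   ∎
    where
    open ℚₚ.≤-Reasoning
    K = k ℕ.+ l
    Y = 1 ÷ℕ (n C 2)
    SP = blocksOf P
    SQ = blocksOf Q
    e4 = 4 ℕ.* (Subset.∣ T ∣ ℕ.* n)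
    e8 = 8 ℕ.* (Subset.∣ T ∣ ℕ.* n)
    potentialP≤ : potential SP K ≤ potential SQ K + ℕ→ℚ e8
    potentialP≤ = begin
      potential SP K                                      ≤⟨ potential-shrink (outside-≤ T SP) K ⟩
      potential (outside T SP) K + ℕ→ℚ (sizeLoss SP (outside T SP) K)
                                                          ≤⟨ ℚₚ.+-monoʳ-≤ (potential (outside T SP) K) (ℕ→ℚ-mono-≤ (sizeLoss-outside P T (ℕₚ.m≤m+n k l))) ⟩
      potential (outside T SP) K + ℕ→ℚ e4                 ≡⟨ cong (_+ ℕ→ℚ e4) (potential-cong (outside-blocksOf-≡ P Q T P≈Q) K) ⟩
      potential (outside T SQ) K + ℕ→ℚ e4                 ≤⟨ ℚₚ.+-monoˡ-≤ (ℕ→ℚ e4) (potential-grow (outside-≤ T SQ) K) ⟩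
      potential SQ K + ℕ→ℚ (sizeLoss SQ (outside T SQ) K) + ℕ→ℚ e4
                                                          ≤⟨ ℚₚ.+-monoˡ-≤ (ℕ→ℚ e4) (ℚₚ.+-monoʳ-≤ (potential SQ K)
                                                               (ℕ→ℚ-mono-≤ (sizeLoss-outside Q T (ℕₚ.m≤n+m l k)))) ⟩
      potential SQ K + ℕ→ℚ e4 + ℕ→ℚ e4                    ≡⟨ ℚₚ.+-assoc (potential SQ K) _ _ ⟩
      potential SQ K + (ℕ→ℚ e4 + ℕ→ℚ e4)                  ≡⟨ cong (potential SQ K +_) (ℕ→ℚ-+ e4 e4) ⟨
      potential SQ K + ℕ→ℚ (e4 ℕ.+ e4)                    ≡⟨ cong (λ x → potential SQ K + ℕ→ℚ x) (ℕₚ.*-distribʳ-+ (Subset.∣ T ∣ ℕ.* n) 4 4) ⟨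
      potential SQ K + ℕ→ℚ e8                             ∎

[n*n]÷ℕ[nC2]≤4 : ∀ n → (n ℕ.* n) ÷ℕ (n C 2) ≤ ℕ→ℚ 4
[n*n]÷ℕ[nC2]≤4 0                   = ℕ→ℚ-nonNeg 4
[n*n]÷ℕ[nC2]≤4 1                   = ℕ→ℚ-nonNeg 4
[n*n]÷ℕ[nC2]≤4 n@(suc (suc _)) = ÷ℕ≤÷ℕ+ℕ→ℚ (n ℕ.* n) (n C 2) 0 1 4 (λ ())
  (subst (ℕ._≤ 4 ℕ.* (n C 2)) (sym (ℕₚ.*-identityʳ (n ℕ.* n))) (n*n≤4*[nC2] n (ℕ.s≤s (ℕ.s≤s ℕ.z≤n))))

[1÷nC2]*8tn≤ε : ∀ n t {ε} → 0ℚ ≤ ε → ℕ→ℚ t ≤ ε * (1 ÷ℕ 32) * ℕ→ℚ n →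
                      1 ÷ℕ (n C 2) * ℕ→ℚ (8 ℕ.* (t ℕ.* n)) ≤ ε
[1÷nC2]*8tn≤ε n t {ε} 0≤ε t≤δn = begin
  Y * ℕ→ℚ (8 ℕ.* (t ℕ.* n))           ≡⟨ cong (Y *_) (trans (cong ℕ→ℚ (*-rearrange 8 t n)) (ℕ→ℚ-* (8 ℕ.* n) t)) ⟩
  Y * (ℕ→ℚ (8 ℕ.* n) * ℕ→ℚ t)         ≡⟨ solve 3 (λ Y A t → Y :* (A :* t) := A :* Y :* t) refl Y (ℕ→ℚ (8 ℕ.* n)) (ℕ→ℚ t) ⟩
  ℕ→ℚ (8 ℕ.* n) * Y * ℕ→ℚ t           ≡⟨ cong (_* ℕ→ℚ t) (÷ℕ≡ℕ→ℚ*1÷ℕ (8 ℕ.* n) (n C 2)) ⟨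
  (8 ℕ.* n) ÷ℕ (n C 2) * ℕ→ℚ t        ≤⟨ *-monoˡ-≤-0≤ (÷ℕ-nonNeg (8 ℕ.* n) (n C 2)) t≤δn ⟩
  (8 ℕ.* n) ÷ℕ (n C 2) * (δ * ℕ→ℚ n)  ≡⟨ cong (_* (δ * ℕ→ℚ n)) (÷ℕ≡ℕ→ℚ*1÷ℕ (8 ℕ.* n) (n C 2)) ⟩
  ℕ→ℚ (8 ℕ.* n) * Y * (δ * ℕ→ℚ n)     ≡⟨ cong (λ x → x * Y * (δ * ℕ→ℚ n)) (ℕ→ℚ-* 8 n) ⟩
  ℕ→ℚ 8 * ℕ→ℚ n * Y * (δ * ℕ→ℚ n)     ≡⟨ solve 4 (λ A N Y D → A :* N :* Y :* (D :* N) := D :* A :* (N :* N :* Y)) refl (ℕ→ℚ 8) (ℕ→ℚ n) Y δ ⟩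
  δ * ℕ→ℚ 8 * (ℕ→ℚ n * ℕ→ℚ n * Y)     ≡⟨ cong (λ x → δ * ℕ→ℚ 8 * (x * Y)) (ℕ→ℚ-* n n) ⟨
  δ * ℕ→ℚ 8 * (ℕ→ℚ (n ℕ.* n) * Y)     ≡⟨ cong (δ * ℕ→ℚ 8 *_) (÷ℕ≡ℕ→ℚ*1÷ℕ (n ℕ.* n) (n C 2)) ⟨
  δ * ℕ→ℚ 8 * ((n ℕ.* n) ÷ℕ (n C 2))  ≤⟨ *-monoˡ-≤-0≤ 0≤δ*8 ([n*n]÷ℕ[nC2]≤4 n) ⟩
  δ * ℕ→ℚ 8 * ℕ→ℚ 4                   ≡⟨ solve 4 (λ E Z A B → E :* Z :* A :* B := E :* ((A :* B) :* Z)) refl ε (1 ÷ℕ 32) (ℕ→ℚ 8) (ℕ→ℚ 4) ⟩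
  ε * (ℕ→ℚ 8 * ℕ→ℚ 4 * (1 ÷ℕ 32))     ≡⟨ cong (λ x → ε * (x * (1 ÷ℕ 32))) (ℕ→ℚ-* 8 4) ⟨
  ε * (ℕ→ℚ 32 * (1 ÷ℕ 32))            ≡⟨ trans (cong (ε *_) (ℕ→ℚ*1÷ℕ≡1 31)) (ℚₚ.*-identityʳ ε) ⟩
  ε                                   ∎
  where
  open ℚₚ.≤-Reasoning
  open +-*-Solver
  Y = 1 ÷ℕ (n C 2)
  δ = ε * (1 ÷ℕ 32)
  0≤δ*8 : 0ℚ ≤ δ * ℕ→ℚ 8
  0≤δ*8 = *-nonNeg (*-nonNeg 0≤ε (÷ℕ-nonNeg 1 32)) (ℕ→ℚ-nonNeg 8)
  *-rearrange : ∀ a b c → a ℕ.* (b ℕ.* c) ≡ a ℕ.* c ℕ.* b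
  *-rearrange a b c = trans (cong (a ℕ.*_) (ℕₚ.*-comm b c)) (sym (ℕₚ.*-assoc a c b))

lemma5p2 : (s : ℕ) → (ε : ℚ) → 0ℚ < ε →
    Σ ℚ λ δ → (0ℚ < δ) ×
      (∀ (n : ℕ) (G : ColoredGraph n s) (k l : ℕ)
         (P : Partition n k) (Q : Partition n l) →
         Close δ P Q → ∣ ind G P - ind G Q ∣ ≤ ε)
lemma5p2 s ε 0<ε = δ , 0<δ , ind-stable
  where
  δ = ε * (1 ÷ℕ 32)

  0<δ : 0ℚ < δ
  0<δ = ℚₚ.positive⁻¹ δ {{ℚₚ.pos*pos⇒pos ε {{positive 0<ε}} (1 ÷ℕ 32)}}

  ind-stable : ∀ n (G : ColoredGraph n s) k l (P : Partition n k) (Q : Partition n l) →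
               Close δ P Q → ∣ ind G P - ind G Q ∣ ≤ ε
  ind-stable n G k l P Q (T , ∣T∣≤δn , P≈Q) = ℚₚ.≤-trans
    (∣x-y∣≤z (Potential.ind-close G P Q T P≈Q) (Potential.ind-close G Q P T (λ i v v∉T → ⇔.sym (P≈Q i v v∉T))))
    ([1÷nC2]*8tn≤ε n Subset.∣ T ∣ (ℚₚ.<⇒≤ 0<ε) ∣T∣≤δn)
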